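{- Let $k\ge2$ and $q\ge1$ be integers and define $M_{k,q}:=\max\{N_{k,q}(S): S\subseteq[q]^{k-1}\}$. Then $M_{k,q}=\alpha_{\operatorname{loop}}(k,q)$. Moreover \[ M_{k,q}\le\alpha(k,q)\le M_{k,q}+q, \] so in particular $\alpha(k,q)=M_{k,q}+O(q)$ for fixed $k$ as $q\to\infty$.
   Context: Let $[q]:=\{0,\dots,q-1\}$. The de Bruijn digraph $B(k,q)$ has vertex set $[q]^k$ and edges $x_1\dots x_k\to x_2\dots x_ky$, $y\in[q]$. In its underlying simple graph (loops deleted), distinct words $x_1\dots x_k$, $y_1\dots y_k$ are adjacent iff $x_2\dots x_k=y_1\dots y_{k-1}$ or $y_2\dots y_k=x_1\dots x_{k-1}$. $\alpha(k,q)$ is the independence number of this simple graph; $\alpha_{\operatorname{loop}}(k,q)$ is the independence number with the $q$ self-loops (at the constant words $a^k$) retained, i.e. the maximum size of an independent set of the simple graph containing no constant word. For $S\subseteq[q]^{k-1}$, $N_{k,q}(S)$ is the number of words $(x_1,\dots,x_k)\in[q]^k$ with $(x_1,\dots,x_{k-1})\in S$ and $(x_2,\dots,x_k)\notin S$. -}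

module Defs where

open import Data.Nat using (ℕ; zero; suc; pred; _≤_)
open import Data.Fin using (Fin)
open import Data.Vec using (Vec; []; _∷_; replicate)
open import Data.List using (List; []; _∷_; map; concatMap; filter; length)
open import Data.List.Membership.Propositional using (_∈_)
open import Data.List.Relation.Unary.Unique.Propositional using (Unique)
open import Data.List.Relation.Unary.All using (All)
open import Data.Bool using (Bool; true; false; T; not; _∧_)
open import Data.Fin using (Fin)
open import Data.Product using (Σ; ∃; _×_; _,_)
open import Data.Sum using (_⊎_)
open import Relation.Binary.PropositionalEquality using (_≡_; _≢_)
open import Relation.Nullary using (¬_)
import Data.List as L
open import Data.Fin using (Fin)

Word : ℕ → ℕ → Set
Word q k = Vec (Fin q) k

allFin : (q : ℕ) → List (Fin q)
allFin q = L.allFin q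

allWords : (q k : ℕ) → List (Word q k)
allWords q zero = [] ∷ []
allWords q (suc k) = concatMap (λ a → map (a ∷_) (allWords q k)) (allFin q)

-- suffix x₂…x_k and prefix x₁…x_{k-1} of a word x₁…x_k
suf : ∀ {A : Set} {k} → Vec A k → Vec A (pred k)
suf [] = []
suf (x ∷ xs) = xs

pre′ : ∀ {A : Set} {n} → A → Vec A n → Vec A n
pre′ x [] = []
pre′ x (y ∷ ys) = x ∷ pre′ y ys

pre : ∀ {A : Set} {k} → Vec A k → Vec A (pred k)
pre [] = []
pre (x ∷ xs) = pre′ x xs

-- adjacency in the underlying simple graph of B(k,q) (for distinct words)
Adj : ∀ {q k} → Word q k → Word q k → Set
Adj x y = suf x ≡ pre y ⊎ suf y ≡ pre x

-- a finite set of words, given as a duplicate-free list, is independent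
-- in the underlying simple graph (loops deleted)
Independent : ∀ {q k} → List (Word q k) → Set
Independent {q} {k} I =
  Unique I × (∀ {x y} → x ∈ I → y ∈ I → x ≢ y → ¬ Adj x y)

Constant : ∀ {q k} → Word q k → Set
Constant {q} {k} x = ∃ λ (a : Fin q) → x ≡ replicate k a

-- independent set when the q self-loops are retained
IndependentLoop : ∀ {q k} → List (Word q k) → Set
IndependentLoop I = Independent I × All (λ x → ¬ Constant x) I

IsMaxSize : ∀ {q k} → (List (Word q k) → Set) → ℕ → Set
IsMaxSize P n = (∃ λ I → P I × length I ≡ n) × (∀ I → P I → length I ≤ n)

IsAlpha : ℕ → ℕ → ℕ → Set
IsAlpha k q n = IsMaxSize {q} {k} Independent n

IsAlphaLoop : ℕ → ℕ → ℕ → Set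
IsAlphaLoop k q n = IsMaxSize {q} {k} IndependentLoop n

SubsetW : ℕ → ℕ → Set
SubsetW q m = Word q m → Bool

N : (k q : ℕ) → SubsetW q (pred k) → ℕ
N k q S = length (filter (λ x → Data.Bool._≟_ (S (pre x) ∧ not (S (suf x))) true) (allWords q k))

IsM : ℕ → ℕ → ℕ → Set
IsM k q n = (∃ λ S → N k q S ≡ n) × (∀ S → N k q S ≤ n)

-- Read the words of [q]^k as the arcs of B(k-1,q), an arc x running from pre x to
-- suf x.  A loop-free independent set of the simple graph is then a set J of arcs
-- none of which can follow another (suf x ≠ pre y for all x, y ∈ J, also x = y,
-- because suf x = pre x exactly for constant x).  Every such J leaves the set S of
-- its own tails, so |J| ≤ N(S); conversely the arcs leaving any S form such a set.
-- Hence M = α_loop ≤ α, and an independent set contains at most the q constant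
-- words besides a loop-free independent set, so α ≤ α_loop + q.
module Submission where

open import Defs
open import Data.Nat using (ℕ; _≤_; _+_)
open import Data.Product using (_×_)
open import Relation.Binary.PropositionalEquality using (_≡_)

open import Data.Nat using (zero; suc; pred; z≤n; s≤s)
open import Data.Nat.Properties using (≤-trans; ≤-antisym; +-monoˡ-≤; +-monoʳ-≤; +-suc; module ≤-Reasoning)
import Data.Fin.Properties as Fin
open import Data.Vec using (Vec; []; _∷_; replicate)
import Data.Vec.Properties as Vec
open import Data.List using (List; []; _∷_; map; filter; length; cartesianProductWith)
import Data.List as List
open import Data.List.Properties using (length-map; length-tabulate; length-removeAt′)
open import Data.List.Membership.Propositional using (_∈_; find; lose)
open import Data.List.Membership.Propositional.Properties
  using (∈-map⁺; ∈-allFin; ∈-filter⁺; ∈-filter⁻; ∈-cartesianProductWith⁺)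
open import Data.List.Relation.Binary.Subset.Propositional using (_⊆_)
open import Data.List.Relation.Unary.Any using (here; there; index; any?; _─_)
open import Data.List.Relation.Unary.All as All using (All)
open import Data.List.Relation.Unary.AllPairs using ([]; _∷_)
open import Data.List.Relation.Unary.Unique.Propositional using (Unique)
import Data.List.Relation.Unary.Unique.Propositional.Properties as Unique
open import Data.Bool using (true; false; not; _∧_)
import Data.Bool as Bool
open import Data.Product using (_,_; proj₁; proj₂)
open import Data.Sum using (inj₁; [_,_])
open import Data.Empty using (⊥-elim)
open import Function using (_∘_)
open import Relation.Nullary using (yes; no; ¬?; does)
open import Relation.Nullary.Decidable using (dec-true; dec-false)
open import Relation.Unary using (Decidable)
open import Relation.Binary.Definitions using (DecidableEquality)
open import Relation.Binary.PropositionalEquality using (refl; sym; trans; cong; subst; _≢_; module ≡-Reasoning)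

module _ {A : Set} where

  ∈-─⁺ : ∀ {x y : A} {ys} (y∈ys : y ∈ ys) → x ∈ ys → x ≢ y → x ∈ (ys ─ y∈ys)
  ∈-─⁺ (here refl) (here refl) x≢y = ⊥-elim (x≢y refl)
  ∈-─⁺ (here _)    (there x∈)  _   = x∈
  ∈-─⁺ (there _)   (here x≡)   _   = here x≡
  ∈-─⁺ (there y∈)  (there x∈)  x≢y = there (∈-─⁺ y∈ x∈ x≢y)

  Unique-⊆⇒length≤ : ∀ {xs ys : List A} → Unique xs → xs ⊆ ys → length xs ≤ length ys
  Unique-⊆⇒length≤ {[]}          _                _     = z≤n
  Unique-⊆⇒length≤ {x ∷ xs} {ys} (x∉xs ∷ xs-uniq) xs⊆ys = begin
    suc (length xs)          ≤⟨ s≤s (Unique-⊆⇒length≤ xs-uniq xs⊆ys─x) ⟩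
    suc (length (ys ─ x∈ys)) ≡⟨ sym (length-removeAt′ ys (index x∈ys)) ⟩
    length ys                ∎
    where
    open ≤-Reasoning
    x∈ys : x ∈ ys
    x∈ys = xs⊆ys (here refl)
    xs⊆ys─x : xs ⊆ (ys ─ x∈ys)
    xs⊆ys─x z∈xs = ∈-─⁺ x∈ys (xs⊆ys (there z∈xs)) λ { refl → All.lookup x∉xs z∈xs refl }

  length≡filter∁+filter : ∀ {P : A → Set} (P? : Decidable P) xs →
                          length xs ≡ length (filter (¬? ∘ P?) xs) + length (filter P? xs)
  length≡filter∁+filter P? []       = refl
  length≡filter∁+filter P? (x ∷ xs) with P? x
  ... | yes _ = trans (cong suc (length≡filter∁+filter P? xs)) (sym (+-suc _ _))
  ... | no  _ = cong suc (length≡filter∁+filter P? xs)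

_≟W_ : ∀ {q k} → DecidableEquality (Word q k)
_≟W_ = Vec.≡-dec Fin._≟_

allWords-suc : ∀ q k → allWords q (suc k) ≡ cartesianProductWith _∷_ (allFin q) (allWords q k)
allWords-suc q k = go (allFin q)
  where
  go : ∀ as →
       List.concatMap (λ a → map (a ∷_) (allWords q k)) as ≡ cartesianProductWith _∷_ as (allWords q k)
  go []       = refl
  go (a ∷ as) = cong (map (a ∷_) (allWords q k) List.++_) (go as)

∈-allWords : ∀ q k (w : Word q k) → w ∈ allWords q k
∈-allWords q zero    []      = here refl
∈-allWords q (suc k) (a ∷ w) rewrite allWords-suc q k =
  ∈-cartesianProductWith⁺ _∷_ (∈-allFin a) (∈-allWords q k w)

allWords-Unique : ∀ q k → Unique (allWords q k)
allWords-Unique q zero    = All.[] ∷ []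
allWords-Unique q (suc k) rewrite allWords-suc q k =
  Unique.cartesianProductWith⁺ _∷_ Vec.∷-injective (Unique.allFin⁺ q) (allWords-Unique q k)

Loop : ∀ {q k} → Word q k → Set
Loop x = suf x ≡ pre x

loop? : ∀ {q k} → Decidable (Loop {q} {k})
loop? x = suf x ≟W pre x

pre′-replicate : ∀ {A : Set} n (a : A) → pre′ a (replicate n a) ≡ replicate n a
pre′-replicate zero    a = refl
pre′-replicate (suc n) a = cong (a ∷_) (pre′-replicate n a)

pre′-fixed⇒replicate : ∀ {A : Set} {n} (a : A) (xs : Vec A n) → xs ≡ pre′ a xs → xs ≡ replicate n a
pre′-fixed⇒replicate a []       _  = refl
pre′-fixed⇒replicate a (b ∷ xs) eq with refl , eq′ ← Vec.∷-injective eq =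
  cong (a ∷_) (pre′-fixed⇒replicate a xs eq′)

constant⇒loop : ∀ {q k} {x : Word q k} → Constant x → Loop x
constant⇒loop {k = zero}  {[]} _          = refl
constant⇒loop {k = suc n}      (a , refl) = sym (pre′-replicate n a)

loop⇒constant : ∀ {q n} {x : Word q (suc n)} → Loop x → Constant x
loop⇒constant {x = a ∷ xs} eq = a , cong (a ∷_) (pre′-fixed⇒replicate a xs eq)

Unique-loops-length≤ : ∀ {q n} {I : List (Word q (suc n))} → Unique I → All Loop I → length I ≤ q
Unique-loops-length≤ {q} {n} {I} I-uniq loops = begin
  length I                                    ≤⟨ Unique-⊆⇒length≤ I-uniq I⊆constants ⟩
  length (map (replicate (suc n)) (allFin q)) ≡⟨ length-map _ (allFin q) ⟩
  length (allFin q)                           ≡⟨ length-tabulate (λ i → i) ⟩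
  q                                           ∎
  where
  open ≤-Reasoning
  I⊆constants : I ⊆ map (replicate (suc n)) (allFin q)
  I⊆constants {x} x∈I with a , refl ← loop⇒constant {x = x} (All.lookup loops x∈I) =
    ∈-map⁺ (replicate (suc n)) (∈-allFin a)

ArcFree : ∀ {q k} → List (Word q k) → Set
ArcFree J = ∀ {x y} → x ∈ J → y ∈ J → suf x ≢ pre y

arcFree⇒independentLoop : ∀ {q k} {J : List (Word q k)} → Unique J → ArcFree J → IndependentLoop J
arcFree⇒independentLoop J-uniq arcFree =
  (J-uniq , λ x∈J y∈J _ → [ arcFree x∈J y∈J , arcFree y∈J x∈J ]) ,
  All.tabulate λ x∈J → arcFree x∈J x∈J ∘ constant⇒loop

independentLoop⇒arcFree : ∀ {q n} {J : List (Word q (suc n))} → IndependentLoop J → ArcFree J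
independentLoop⇒arcFree ((_ , indep) , nonConstant) {x} {y} x∈J y∈J x→y with x ≟W y
... | yes refl = All.lookup nonConstant x∈J (loop⇒constant x→y)
... | no  x≢y  = indep x∈J y∈J x≢y (inj₁ x→y)

outArc? : ∀ {q k} (S : SubsetW q (pred k)) → Decidable (λ (x : Word q k) → S (pre x) ∧ not (S (suf x)) ≡ true)
outArc? S x = S (pre x) ∧ not (S (suf x)) Bool.≟ true

outArcs : ∀ {q k} → SubsetW q (pred k) → List (Word q k)
outArcs {q} {k} S = filter (outArc? S) (allWords q k)

∈-outArcs⁻ : ∀ {q k} (S : SubsetW q (pred k)) {x} → x ∈ outArcs S →
             S (pre x) ≡ true × S (suf x) ≡ false
∈-outArcs⁻ {q} {k} S {x} x∈ with S (pre x) | S (suf x) | proj₂ (∈-filter⁻ (outArc? S) {xs = allWords q k} x∈)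
... | true | false | _ = refl , refl

∈-outArcs⁺ : ∀ {q k} (S : SubsetW q (pred k)) {x : Word q k} →
             S (pre x) ≡ true → S (suf x) ≡ false → x ∈ outArcs S
∈-outArcs⁺ {q} {k} S {x} pre∈S suf∉S =
  ∈-filter⁺ (outArc? S) (∈-allWords q k x)
    (subst (λ b → b ∧ not (S (suf x)) ≡ true) (sym pre∈S) (cong not suf∉S))

outArcs-arcFree : ∀ {q k} (S : SubsetW q (pred k)) → ArcFree (outArcs S)
outArcs-arcFree {q} {k} S {x} {y} x∈ y∈ x→y = true≢false (begin
  true       ≡⟨ sym (proj₁ (∈-outArcs⁻ {q} {k} S y∈)) ⟩
  S (pre y)  ≡⟨ cong S (sym x→y) ⟩
  S (suf x)  ≡⟨ proj₂ (∈-outArcs⁻ {q} {k} S x∈) ⟩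
  false      ∎)
  where
  open ≡-Reasoning
  true≢false : true ≢ false
  true≢false ()

outArcs-independentLoop : ∀ {q k} (S : SubsetW q (pred k)) → IndependentLoop (outArcs S)
outArcs-independentLoop {q} {k} S =
  arcFree⇒independentLoop (Unique.filter⁺ _ (allWords-Unique q k)) (outArcs-arcFree S)

tails : ∀ {q n} → List (Word q (suc n)) → SubsetW q n
tails J w = does (any? (λ x → pre x ≟W w) J)

arcFree⇒length≤N-tails : ∀ {q n} {J : List (Word q (suc n))} → Unique J → ArcFree J →
                         length J ≤ N (suc n) q (tails J)
arcFree⇒length≤N-tails {J = J} J-uniq arcFree = Unique-⊆⇒length≤ J-uniq J⊆outArcs
  where
  J⊆outArcs : J ⊆ outArcs (tails J)
  J⊆outArcs {x} x∈J = ∈-outArcs⁺ (tails J)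
    (dec-true (any? (λ y → pre y ≟W pre x) J) (lose x∈J refl))
    (dec-false (any? (λ y → pre y ≟W suf x) J) λ y∈tails →
      let y , y∈J , x→y = find y∈tails in arcFree x∈J y∈J (sym x→y))

nonLoops : ∀ {q k} → List (Word q k) → List (Word q k)
nonLoops = filter (¬? ∘ loop?)

independent-length≤nonLoops+q : ∀ {q n} {I : List (Word q (suc n))} → Independent I →
                                length I ≤ length (nonLoops I) + q
independent-length≤nonLoops+q {q} {I = I} (I-uniq , _) = begin
  length I                                             ≡⟨ length≡filter∁+filter loop? I ⟩
  length (nonLoops I) + length (filter loop? I)        ≤⟨ +-monoʳ-≤ (length (nonLoops I)) loops≤q ⟩
  length (nonLoops I) + q                              ∎
  where
  open ≤-Reasoning
  loops≤q : length (filter loop? I) ≤ q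
  loops≤q = Unique-loops-length≤ (Unique.filter⁺ loop? I-uniq)
              (All.tabulate λ x∈ → proj₂ (∈-filter⁻ loop? {xs = I} x∈))

nonLoops-independentLoop : ∀ {q n} {I : List (Word q (suc n))} → Independent I →
                           IndependentLoop (nonLoops I)
nonLoops-independentLoop {I = I} (I-uniq , indep) =
  (Unique.filter⁺ _ I-uniq , λ x∈ y∈ → indep (nonLoops⊆ x∈) (nonLoops⊆ y∈)) ,
  All.tabulate λ x∈ → proj₂ (∈-filter⁻ (¬? ∘ loop?) {xs = I} x∈) ∘ constant⇒loop
  where
  nonLoops⊆ : nonLoops I ⊆ I
  nonLoops⊆ x∈ = proj₁ (∈-filter⁻ (¬? ∘ loop?) {xs = I} x∈)

proposition2p2 : (k q : ℕ) → 2 ≤ k → 1 ≤ q →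
    (M a aL : ℕ) → IsM k q M → IsAlpha k q a → IsAlphaLoop k q aL →
    (M ≡ aL) × (M ≤ a) × (a ≤ M + q)
proposition2p2 (suc n) q (s≤s _) _ M a aL
  ((S , NS≡M) , N≤M) ((I , I-indep , |I|≡a) , α-max)
  ((J , J-indep@((J-uniq , _) , _) , |J|≡aL) , αloop-max) =
  ≤-antisym M≤aL aL≤M , M≤a , a≤M+q
  where
  M≤aL : M ≤ aL
  M≤aL = subst (_≤ aL) NS≡M (αloop-max (outArcs S) (outArcs-independentLoop S))
  aL≤M : aL ≤ M
  aL≤M = subst (_≤ M) |J|≡aL
    (≤-trans (arcFree⇒length≤N-tails J-uniq (independentLoop⇒arcFree J-indep))
             (N≤M (tails J)))
  M≤a : M ≤ a
  M≤a = subst (_≤ a) NS≡M (α-max (outArcs S) (proj₁ (outArcs-independentLoop S)))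
  a≤M+q : a ≤ M + q
  a≤M+q = subst (_≤ M + q) |I|≡a
    (≤-trans (independent-length≤nonLoops+q I-indep)
             (+-monoˡ-≤ q (≤-trans (αloop-max _ (nonLoops-independentLoop I-indep)) aL≤M)))
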